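{- Let $G$ be a looped simple graph and $B\in\mathcal{T}(G)$ a transversal that is a basis of $M[IAS(G)]$. Suppose $C\in\mathcal{T}(G)$ satisfies $B\cap C=\emptyset$. For $v\in V(G)$ let $B(v)$ and $C(v)$ denote the elements of $\tau_G(v)$ lying in $B$ and in $C$ respectively. Let $H$ be the graph with $V(H)=V(G)$ in which two distinct vertices $v$ and $w$ are neighbors if and only if $B(w)$ is an element of the fundamental circuit of $C(v)$ with respect to $B$ in $M[IAS(G)]$. Then $G$ and $H$ are locally equivalent, and there is an induced isomorphism $\beta: M[IAS(G)]\to M[IAS(H)]$ with $\beta(B)=\Phi(H)$.
   Context: A looped simple graph is a finite graph with loops allowed but no two edges on the same set of end-vertices; neighbors are distinct adjacent vertices, $N_G(v)$ the open neighborhood. $A(G)$ is the adjacency matrix over $GF(2)$ with diagonal entry $1$ exactly at looped vertices. $IAS(G)=(I\;A(G)\;A(G)+I)$ over $GF(2)$, with $v$ columns labeled $\phi_G(v),\chi_G(v),\psi_G(v)$; $W(G)$ is the set of labels and $M[IAS(G)]$ the binary matroid on $W(G)$ represented by $IAS(G)$. $\tau_G(v)=\{\phi_G(v),\chi_G(v),\psi_G(v)\}$ is the vertex triple; $\mathcal{T}(G)$ is the set of transversals (subsets of $W(G)$ containing exactly one element of each vertex triple); $\Phi(H)=\{\phi_H(v)\mid v\in V(H)\}$. For a basis $B$ and element $e\notin B$, the fundamental circuit is the unique circuit contained in $B\cup\{e\}$. Local equivalence: $G^v_\ell$ complements the loop status of $v$; $G^v_s$ complements the adjacency status of every pair of distinct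 neighbors of $v$; $G^v_{ns}$ does the same and also complements the loop status of every neighbor of $v$. $H$ is locally equivalent to $G$ if obtained from $G$ by a finite sequence of such operations. For $*\in\{\ell,s,ns\}$ there is an isomorphism $\beta^v_*: M[IAS(G)]\to M[IAS(G^v_*)]$ with $\beta^v_*(\alpha_G(x))=\alpha_{G^v_*}(x)$ for all $\alpha\in\{\phi,\chi,\psi\}$, $x\in V(G)$, except: $\beta^v_\ell$ swaps $\chi(v)$ and $\psi(v)$; $\beta^v_{ns}$ sends $\phi_G(v)\mapsto\psi(v)$, $\psi_G(v)\mapsto \phi(v)$ if $v$ is unlooped, and $\phi_G(v)\mapsto\chi(v)$, $\chi_G(v)\mapsto\phi(v)$ if $v$ is looped; $\beta^v_s$ has the same exceptions at $v$ as $\beta^v_{ns}$ and additionally, for each $w\in N_G(v)$, $\chi_G(w)\mapsto \psi(w)$ and $\psi_G(w)\mapsto\chi(w)$. An induced isomorphism is a composition of such maps along a sequence of operations transforming $G$ into $H$. -}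

module Defs where

open import Data.Nat using (ℕ)
open import Data.Bool using (Bool; true; false; not; _∧_; _∨_; _xor_; if_then_else_)
open import Data.Fin using (Fin)
open import Data.Fin.Properties using (_≟_)
open import Data.List using (List; []; _∷_; map; foldr; allFin; concatMap)
open import Data.Product using (_×_; _,_; proj₁; proj₂; ∃)
open import Relation.Nullary using (¬_)
open import Relation.Nullary.Decidable using (⌊_⌋)
open import Relation.Binary.PropositionalEquality using (_≡_; _≢_)
open import Function using (id; _∘_)

-- Looped simple graphs on vertex set Fin n, given by the GF(2)
-- adjacency matrix A(G) (Bool = GF(2), xor = +); diagonal entry true
-- exactly at looped vertices.  Symmetry is the "simple graph" condition.

Graph : ℕ → Set
Graph n = Fin n → Fin n → Bool

Symmetric : ∀ {n} → Graph n → Set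
Symmetric {n} G = ∀ (x y : Fin n) → G x y ≡ G y x

_==_ : ∀ {n} → Fin n → Fin n → Bool
x == y = ⌊ x ≟ y ⌋

isNbr : ∀ {n} → Graph n → Fin n → Fin n → Bool
isNbr G v w = not (v == w) ∧ G v w

-- The ground set W(G) of M[IAS(G)]: labels φ(v), χ(v), ψ(v).

data Label : Set where
  φ χ ψ : Label

W : ℕ → Set
W n = Fin n × Label

eqL : Label → Label → Bool
eqL φ φ = true
eqL χ χ = true
eqL ψ ψ = true
eqL _ _ = false

labels : List Label
labels = φ ∷ χ ∷ ψ ∷ []

elems : (n : ℕ) → List (W n)
elems n = concatMap (λ v → map (λ a → (v , a)) labels) (allFin n)

-- Column of IAS(G) = (I  A(G)  A(G)+I) labelled by e, as a vector in GF(2)^n.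
col : ∀ {n} → Graph n → W n → Fin n → Bool
col G (v , φ) i = i == v
col G (v , χ) i = G i v
col G (v , ψ) i = G i v xor (i == v)

Subset : ℕ → Set
Subset n = W n → Bool

_∈_ : ∀ {n} → W n → Subset n → Set
e ∈ S = S e ≡ true

_⊆_ : ∀ {n} → Subset n → Subset n → Set
S ⊆ T = ∀ e → e ∈ S → e ∈ T

insert : ∀ {n} → W n → Subset n → Subset n
insert (v , a) S (w , b) = ((v == w) ∧ eqL a b) ∨ S (w , b)

sumCols : ∀ {n} → Graph n → Subset n → Fin n → Bool
sumCols {n} G T i = foldr _xor_ false (map (λ e → T e ∧ col G e i) (elems n))

Dependent : ∀ {n} → Graph n → Subset n → Set
Dependent G S = ∃ λ T → T ⊆ S × (∃ λ e → e ∈ T) × (∀ i → sumCols G T i ≡ false)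

Independent : ∀ {n} → Graph n → Subset n → Set
Independent G S = ¬ Dependent G S

IsBasis : ∀ {n} → Graph n → Subset n → Set
IsBasis G B = Independent G B × (∀ S → B ⊆ S → Independent G S → S ⊆ B)

IsCircuit : ∀ {n} → Graph n → Subset n → Set
IsCircuit G D = Dependent G D × (∀ T → T ⊆ D → Dependent G T → D ⊆ T)

-- x is an element of the fundamental circuit of e with respect to B
-- (the circuit contained in B ∪ {e}, unique when B is a basis, e ∉ B)
InFundCircuit : ∀ {n} → Graph n → Subset n → W n → W n → Set
InFundCircuit G B e x = ∃ λ D → IsCircuit G D × D ⊆ insert e B × x ∈ D

-- Transversals: exactly one element of each vertex triple τ(v);
-- encoded by the choice function v ↦ label of the chosen element.

Transversal : ℕ → Set
Transversal n = Fin n → Label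

toSubset : ∀ {n} → Transversal n → Subset n
toSubset T (v , a) = eqL (T v) a

data Op (n : ℕ) : Set where
  opℓ ops opns : Fin n → Op n

step : ∀ {n} → Op n → Graph n → Graph n
step (opℓ v) G x y = ((x == v) ∧ (y == v)) xor G x y
step (ops v) G x y =
  (not (x == y) ∧ isNbr G v x ∧ isNbr G v y) xor G x y
step (opns v) G x y = (isNbr G v x ∧ isNbr G v y) xor G x y

swap : Label → Label → Label → Label
swap a b c = if eqL c a then b else (if eqL c b then a else c)

-- the isomorphism β^v_* : M[IAS(G)] → M[IAS(G^v_*)] on ground elements
-- (G is the graph before the operation)
stepβ : ∀ {n} → Op n → Graph n → W n → W n
stepβ (opℓ v) G (x , a) =
  (x , (if x == v then swap χ ψ a else a))
stepβ (opns v) G (x , a) =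
  (x , (if x == v then (if G v v then swap φ χ a else swap φ ψ a) else a))
stepβ (ops v) G (x , a) =
  (x , (if x == v then (if G v v then swap φ χ a else swap φ ψ a)
        else (if isNbr G v x then swap χ ψ a else a)))

apply : ∀ {n} → List (Op n) → Graph n → Graph n
apply [] G = G
apply (o ∷ os) G = apply os (step o G)

induced : ∀ {n} → List (Op n) → Graph n → W n → W n
induced [] G = id
induced (o ∷ os) G = induced os (step o G) ∘ stepβ o G

_≈G_ : ∀ {n} → Graph n → Graph n → Set
G ≈G H = ∀ x y → G x y ≡ H x y

module Submission where

-- A pivot G ↦ G^v_ns comes with an injective
-- GF(2)-linear map P such that, column by column,
--   column of β^v_ns(e) in IAS(G^v_ns)  =  P (column of e in IAS(G)),
-- which is the matrix form of "β^v_ns is an isomorphism of binary matroids";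
-- sequences of operations with this property are called *realized*, and they
-- compose.  The proof has three steps.
--  (1) Pivoting.  As B is independent, a sequence of ns-operations (one or two
--      per vertex, found by a worklist recursion) turns G into a graph G₁ whose
--      induced isomorphism maps B(v) to φ(v) for every v.
--  (2) Fundamental circuits.  For any e = (x , c) with c ≠ B(x), the fundamental
--      circuit of e with respect to B consists of e and the B(w) with μ(w) = 1,
--      where μ is the unique coefficient vector expressing the column of e in
--      the columns of B.  After pivoting μ = P(column of e), which is the column
--      of the image of e in IAS(G₁); its w-entry is A(G₁)(w , x) for w ≠ x.
--      Hence G₁ and H agree off the diagonal.
--  (3) Loops.  ℓ-operations make the diagonal agree with H; they fix every φ.

open import Defs
open import Data.Nat using (ℕ; zero; suc)
open import Data.Bool using (Bool; true; false; not; _∧_; _∨_; _xor_; if_then_else_)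
open import Data.Bool.Properties
  using (xor-same; xor-identityʳ; xor-assoc; xor-comm; ∧-zeroʳ; ∧-identityʳ; ∧-comm;
         ∧-distribʳ-xor; ∧-conicalˡ; ∧-conicalʳ; ¬-not; if-eta; xor-∧-commutativeRing)
  renaming (_≟_ to _≟B_)
open import Data.Fin using (Fin; zero; suc)
open import Data.Fin.Properties using (_≟_; any?)
open import Data.List using (List; []; _∷_; _++_; map; foldr; tabulate; allFin; concatMap)
open import Data.List.Relation.Unary.Any using (here; there; tail)
open import Data.List.Membership.Propositional using () renaming (_∈_ to _∈ₗ_)
open import Data.List.Membership.Propositional.Properties using (∈-allFin)
open import Data.Product using (_×_; _,_; ∃; Σ; proj₁; proj₂)
open import Data.Sum using (_⊎_; inj₁; inj₂)
open import Relation.Nullary using (Dec; yes; no; contradiction; ¬?)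
open import Relation.Nullary.Decidable using (_×-dec_)
open import Relation.Binary.PropositionalEquality
  using (_≡_; _≢_; refl; sym; trans; cong; cong₂; ≢-sym; module ≡-Reasoning)
open import Function using (id; _∘_)
open import Function.Bundles using (_⇔_; Equivalence; mk⇔)
open import Function.Properties.Equivalence using () renaming (trans to ⇔-trans)
open import Algebra.Bundles using (CommutativeRing)
open import Algebra.Properties.CommutativeSemigroup
  (CommutativeRing.+-commutativeSemigroup xor-∧-commutativeRing) using (interchange; xy∙z≈yz∙x)
open import Algebra.Properties.CommutativeMonoid.Sum
  (CommutativeRing.+-commutativeMonoid xor-∧-commutativeRing)
  using (sum; ∑-distrib-+; sum-cong-≗; sum-replicate-zero)

open ≡-Reasoning

xor-cancelʳ : ∀ a b → (a xor b) xor b ≡ a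
xor-cancelʳ a b = trans (xor-assoc a b b) (trans (cong (a xor_) (xor-same b)) (xor-identityʳ a))

xor≡false⇒≡ : ∀ a b → a xor b ≡ false → a ≡ b
xor≡false⇒≡ a b h = trans (sym (xor-cancelʳ a b)) (cong (_xor b) h)

∨-true : ∀ {p q} → p ∨ q ≡ true → p ≡ true ⊎ q ≡ true
∨-true {true} _ = inj₁ refl
∨-true {false} h = inj₂ h

∨-∧-weaken : ∀ p q r → p ∨ (q ∧ r) ≡ true → p ∨ q ≡ true
∨-∧-weaken true q r _ = refl
∨-∧-weaken false true r _ = refl
∨-∧-weaken false false r ()

⇔-true⇒≡ : ∀ {a b} → (a ≡ true ⇔ b ≡ true) → a ≡ b
⇔-true⇒≡ {true} {true} _ = refl
⇔-true⇒≡ {false} {false} _ = refl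
⇔-true⇒≡ {true} {false} h = sym (Equivalence.to h refl)
⇔-true⇒≡ {false} {true} h = Equivalence.from h refl

==-refl : ∀ {n} (x : Fin n) → (x == x) ≡ true
==-refl x with x ≟ x
... | yes _ = refl
... | no x≢x = contradiction refl x≢x

==-≢ : ∀ {n} {x y : Fin n} → x ≢ y → (x == y) ≡ false
==-≢ {x = x} {y} x≢y with x ≟ y
... | yes x≡y = contradiction x≡y x≢y
... | no _ = refl

==-suc : ∀ {n} (x y : Fin n) → (suc x == suc y) ≡ (x == y)
==-suc x y with x ≟ y
... | yes _ = refl
... | no _ = refl

==-≡ : ∀ {n} {x y : Fin n} → (x == y) ≡ true → x ≡ y
==-≡ {x = x} {y} h with x ≟ y
... | yes x≡y = x≡y
... | no _ = contradiction h λ ()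

_≟L_ : (a b : Label) → Dec (a ≡ b)
φ ≟L φ = yes refl
χ ≟L χ = yes refl
ψ ≟L ψ = yes refl
φ ≟L χ = no λ ()
φ ≟L ψ = no λ ()
χ ≟L φ = no λ ()
χ ≟L ψ = no λ ()
ψ ≟L φ = no λ ()
ψ ≟L χ = no λ ()

eqL-refl : ∀ a → eqL a a ≡ true
eqL-refl φ = refl
eqL-refl χ = refl
eqL-refl ψ = refl

eqL-≡ : ∀ {a b} → eqL a b ≡ true → a ≡ b
eqL-≡ {φ} {φ} _ = refl
eqL-≡ {χ} {χ} _ = refl
eqL-≡ {ψ} {ψ} _ = refl
eqL-≡ {φ} {χ} ()
eqL-≡ {φ} {ψ} ()
eqL-≡ {χ} {φ} ()
eqL-≡ {χ} {ψ} ()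
eqL-≡ {ψ} {φ} ()
eqL-≡ {ψ} {χ} ()

eqL-≢ : ∀ {a b} → a ≢ b → eqL a b ≡ false
eqL-≢ {a} {b} a≢b = ¬-not (a≢b ∘ eqL-≡)

swap-involutive : ∀ p q c → swap p q (swap p q c) ≡ c
swap-involutive p q c with eqL c p in c≡p
... | true with eqL q p in q≡p
...   | true = trans (eqL-≡ q≡p) (sym (eqL-≡ c≡p))
...   | false rewrite eqL-refl q = sym (eqL-≡ c≡p)
swap-involutive p q c | false with eqL c q in c≡q
...   | true rewrite eqL-refl p = sym (eqL-≡ c≡q)
...   | false rewrite c≡p | c≡q = refl

sum-zero : ∀ {n} (f : Fin n → Bool) → (∀ w → f w ≡ false) → sum f ≡ false
sum-zero {n} f h = trans (sum-cong-≗ h) (sum-replicate-zero n)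

sum-sift : ∀ {n} (x : Fin n) (u : Fin n → Bool) → sum (λ w → u w ∧ (x == w)) ≡ u x
sum-sift {suc n} zero u = begin
  (u zero ∧ true) xor sum (λ w → u (suc w) ∧ false)
    ≡⟨ cong₂ _xor_ (∧-identityʳ (u zero)) (sum-zero _ (λ w → ∧-zeroʳ (u (suc w)))) ⟩
  u zero xor false
    ≡⟨ xor-identityʳ (u zero) ⟩
  u zero ∎
sum-sift {suc n} (suc x) u rewrite ∧-zeroʳ (u zero) =
  trans (sum-cong-≗ (λ w → cong (u (suc w) ∧_) (==-suc x w))) (sum-sift x (λ w → u (suc w)))

Column : ℕ → Set
Column n = Fin n → Bool

combination : ∀ {m n} → (Fin m → Bool) → (Fin m → Column n) → Column n
combination μ v i = sum (λ w → μ w ∧ v w i)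

combination-xor : ∀ {m n} (μ ν : Fin m → Bool) (v : Fin m → Column n) i →
  combination (λ w → μ w xor ν w) v i ≡ combination μ v i xor combination ν v i
combination-xor μ ν v i =
  trans (sum-cong-≗ (λ w → ∧-distribʳ-xor (v w i) (μ w) (ν w)))
        (∑-distrib-+ (λ w → μ w ∧ v w i) (λ w → ν w ∧ v w i))

Στ : (Label → Bool) → Bool
Στ g = g φ xor (g χ xor (g ψ xor false))

Στ-cong : ∀ {f g} → (∀ a → f a ≡ g a) → Στ f ≡ Στ g
Στ-cong h = cong₂ _xor_ (h φ) (cong₂ _xor_ (h χ) (cong (_xor false) (h ψ)))

Στ-xor : ∀ (f g : Label → Bool) → Στ (λ a → f a xor g a) ≡ Στ f xor Στ g
Στ-xor f g = begin
  (f φ xor g φ) xor ((f χ xor g χ) xor ((f ψ xor g ψ) xor false))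
    ≡⟨ cong (λ t → (f φ xor g φ) xor ((f χ xor g χ) xor t)) (interchange (f ψ) (g ψ) false false) ⟩
  (f φ xor g φ) xor ((f χ xor g χ) xor ((f ψ xor false) xor (g ψ xor false)))
    ≡⟨ cong ((f φ xor g φ) xor_) (interchange (f χ) (g χ) _ _) ⟩
  (f φ xor g φ) xor ((f χ xor (f ψ xor false)) xor (g χ xor (g ψ xor false)))
    ≡⟨ interchange (f φ) (g φ) _ _ ⟩
  Στ f xor Στ g ∎

Στ-indicator : ∀ b (k : Bool) → Στ (λ a → eqL b a ∧ k) ≡ k
Στ-indicator φ k = xor-identityʳ k
Στ-indicator χ k = xor-identityʳ k
Στ-indicator ψ k = xor-identityʳ k

expand-single : ∀ (g : Label → Bool) b → (∀ a → g a ≡ true → b ≡ a) →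
  ∀ a → g a ≡ eqL b a ∧ g b
expand-single g b supp a with b ≟L a
... | yes refl = sym (cong (_∧ g b) (eqL-refl b))
... | no b≢a = trans (¬-not (b≢a ∘ supp a)) (cong (_∧ g b) (sym (eqL-≢ b≢a)))

expand-pair : ∀ (g : Label → Bool) b c → b ≢ c → (∀ a → g a ≡ true → b ≡ a ⊎ c ≡ a) →
  ∀ a → g a ≡ (eqL b a ∧ g b) xor (eqL c a ∧ g c)
expand-pair g b c b≢c supp a with b ≟L a | c ≟L a
... | yes refl | yes refl = contradiction refl b≢c
... | yes refl | no c≢b rewrite eqL-refl b | eqL-≢ c≢b = sym (xor-identityʳ (g b))
... | no b≢a | yes refl rewrite eqL-≢ b≢a | eqL-refl c = refl
... | no b≢a | no c≢a rewrite eqL-≢ b≢a | eqL-≢ c≢a = ¬-not offSupport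
  where
  offSupport : g a ≢ true
  offSupport h with supp a h
  ... | inj₁ b≡a = b≢a b≡a
  ... | inj₂ c≡a = c≢a c≡a

Στ-single : ∀ (g : Label → Bool) b → (∀ a → g a ≡ true → b ≡ a) → Στ g ≡ g b
Στ-single g b supp = trans (Στ-cong (expand-single g b supp)) (Στ-indicator b (g b))

Στ-pair : ∀ (g : Label → Bool) b c → b ≢ c → (∀ a → g a ≡ true → b ≡ a ⊎ c ≡ a) →
  Στ g ≡ g b xor g c
Στ-pair g b c b≢c supp = begin
  Στ g
    ≡⟨ Στ-cong (expand-pair g b c b≢c supp) ⟩
  Στ (λ a → (eqL b a ∧ g b) xor (eqL c a ∧ g c))
    ≡⟨ Στ-xor (λ a → eqL b a ∧ g b) (λ a → eqL c a ∧ g c) ⟩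
  Στ (λ a → eqL b a ∧ g b) xor Στ (λ a → eqL c a ∧ g c)
    ≡⟨ cong₂ _xor_ (Στ-indicator b (g b)) (Στ-indicator c (g c)) ⟩
  g b xor g c ∎

sumCols-by-vertex : ∀ {n} (G : Graph n) (T : Subset n) i →
  sumCols G T i ≡ sum (λ w → Στ (λ a → T (w , a) ∧ col G (w , a) i))
sumCols-by-vertex {n} G T i = by-tabulate n id
  where
  F : W n → Bool
  F e = T e ∧ col G e i
  xorAll : List (W n) → Bool
  xorAll es = foldr _xor_ false (map F es)
  xorAll-++ : ∀ es fs → xorAll (es ++ fs) ≡ xorAll es xor xorAll fs
  xorAll-++ [] fs = refl
  xorAll-++ (e ∷ es) fs = trans (cong (F e xor_) (xorAll-++ es fs)) (sym (xor-assoc (F e) _ _))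
  triple : Fin n → List (W n)
  triple v = map (λ a → (v , a)) labels
  by-tabulate : ∀ m (h : Fin m → Fin n) →
    xorAll (concatMap triple (tabulate h)) ≡ sum (λ w → Στ (λ a → F (h w , a)))
  by-tabulate zero h = refl
  by-tabulate (suc m) h =
    trans (xorAll-++ (triple (h zero)) (concatMap triple (tabulate (h ∘ suc))))
          (cong (Στ (λ a → F (h zero , a)) xor_) (by-tabulate m (h ∘ suc)))

columns : ∀ {n} → Graph n → Transversal n → Fin n → Column n
columns K D w = col K (w , D w)

select : ∀ {n} → Transversal n → (Fin n → Bool) → Subset n
select D μ (v , a) = eqL (D v) a ∧ μ v

sumCols-select : ∀ {n} (G : Graph n) D μ i → sumCols G (select D μ) i ≡ combination μ (columns G D) i
sumCols-select G D μ i = trans (sumCols-by-vertex G (select D μ) i) (sum-cong-≗ vertexTerm)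
  where
  vertexTerm : ∀ w → Στ (λ a → (eqL (D w) a ∧ μ w) ∧ col G (w , a) i) ≡ μ w ∧ col G (w , D w) i
  vertexTerm w = trans (Στ-single (λ a → (eqL (D w) a ∧ μ w) ∧ col G (w , a) i) (D w)
                                  (λ a h → eqL-≡ (∧-conicalˡ _ _ (∧-conicalˡ _ _ h))))
                       (cong (λ t → (t ∧ μ w) ∧ col G (w , D w) i) (eqL-refl (D w)))

sumCols-split : ∀ {n} (G : Graph n) (B : Transversal n) x c → B x ≢ c →
  ∀ (T : Subset n) → T ⊆ insert (x , c) (toSubset B) → ∀ i →
  sumCols G T i ≡ (T (x , c) ∧ col G (x , c) i) xor combination (λ w → T (w , B w)) (columns G B) i
sumCols-split {n} G B x c Bx≢c T T⊆ i = begin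
  sumCols G T i
    ≡⟨ sumCols-by-vertex G T i ⟩
  sum (λ w → Στ (λ a → F (w , a)))
    ≡⟨ sum-cong-≗ vertexTerm ⟩
  sum (λ w → (F (x , c) ∧ (x == w)) xor F (w , B w))
    ≡⟨ ∑-distrib-+ (λ w → F (x , c) ∧ (x == w)) (λ w → F (w , B w)) ⟩
  sum (λ w → F (x , c) ∧ (x == w)) xor sum (λ w → F (w , B w))
    ≡⟨ cong (_xor sum (λ w → F (w , B w))) (sum-sift x (λ _ → F (x , c))) ⟩
  F (x , c) xor sum (λ w → F (w , B w)) ∎
  where
  F : W n → Bool
  F e = T e ∧ col G e i
  support : ∀ w a → F (w , a) ≡ true → ((x == w) ∧ eqL c a) ∨ eqL (B w) a ≡ true
  support w a h = T⊆ (w , a) (∧-conicalˡ _ _ h)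
  atCentre : ∀ a → F (x , a) ≡ true → c ≡ a ⊎ B x ≡ a
  atCentre a h with ∨-true {(x == x) ∧ eqL c a} (support x a h)
  ... | inj₁ h₁ = inj₁ (eqL-≡ (∧-conicalʳ _ _ h₁))
  ... | inj₂ h₂ = inj₂ (eqL-≡ h₂)
  away : ∀ w → x ≢ w → ∀ a → F (w , a) ≡ true → B w ≡ a
  away w x≢w a h with ∨-true {(x == w) ∧ eqL c a} (support w a h)
  ... | inj₁ h₁ = contradiction (==-≡ (∧-conicalˡ _ _ h₁)) x≢w
  ... | inj₂ h₂ = eqL-≡ h₂
  vertexTerm : ∀ w → Στ (λ a → F (w , a)) ≡ (F (x , c) ∧ (x == w)) xor F (w , B w)
  vertexTerm w with x ≟ w
  ... | yes refl = trans (Στ-pair (λ a → F (w , a)) c (B w) (≢-sym Bx≢c) atCentre)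
                         (cong (_xor F (w , B w)) (sym (∧-identityʳ (F (w , c)))))
  ... | no x≢w = trans (Στ-single (λ a → F (w , a)) (B w) (away w x≢w))
                       (cong (_xor F (w , B w)) (sym (∧-zeroʳ (F (x , c)))))

apply-++ : ∀ {n} (os₁ os₂ : List (Op n)) K → apply (os₁ ++ os₂) K ≡ apply os₂ (apply os₁ K)
apply-++ [] os₂ K = refl
apply-++ (o ∷ os₁) os₂ K = apply-++ os₁ os₂ (step o K)

induced-++ : ∀ {n} (os₁ os₂ : List (Op n)) K e →
  induced (os₁ ++ os₂) K e ≡ induced os₂ (apply os₁ K) (induced os₁ K e)
induced-++ [] os₂ K e = refl
induced-++ (o ∷ os₁) os₂ K e = induced-++ os₁ os₂ (step o K) (stepβ o K e)

stepLabel : ∀ {n} → Op n → Graph n → Fin n → Label → Label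
stepLabel o K y a = proj₂ (stepβ o K (y , a))

label : ∀ {n} → List (Op n) → Graph n → Fin n → Label → Label
label os K y a = proj₂ (induced os K (y , a))

induced-vertex : ∀ {n} (os : List (Op n)) K y a → induced os K (y , a) ≡ (y , label os K y a)
induced-vertex [] K y a = refl
induced-vertex (opℓ v ∷ os) K y a = induced-vertex os _ y _
induced-vertex (ops v ∷ os) K y a = induced-vertex os _ y _
induced-vertex (opns v ∷ os) K y a = induced-vertex os _ y _

label-++ : ∀ {n} (os₁ os₂ : List (Op n)) K y a →
  label (os₁ ++ os₂) K y a ≡ label os₂ (apply os₁ K) y (label os₁ K y a)
label-++ os₁ os₂ K y a =
  cong proj₂ (trans (induced-++ os₁ os₂ K (y , a))
                    (cong (induced os₂ (apply os₁ K)) (induced-vertex os₁ K y a)))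

stepLabel-involutive : ∀ {n} (o : Op n) K y a → stepLabel o K y (stepLabel o K y a) ≡ a
stepLabel-involutive (opℓ v) K y a with y == v
... | true = swap-involutive χ ψ a
... | false = refl
stepLabel-involutive (opns v) K y a with y == v | K v v
... | true | true = swap-involutive φ χ a
... | true | false = swap-involutive φ ψ a
... | false | _ = refl
stepLabel-involutive (ops v) K y a with y == v | K v v | isNbr K v y
... | true | true | _ = swap-involutive φ χ a
... | true | false | _ = swap-involutive φ ψ a
... | false | _ | true = swap-involutive χ ψ a
... | false | _ | false = refl

label-injective : ∀ {n} (os : List (Op n)) K y {a b} → label os K y a ≡ label os K y b → a ≡ b
label-injective [] K y e = e
label-injective (o ∷ os) K y {a} {b} e = begin
  a
    ≡⟨ sym (stepLabel-involutive o K y a) ⟩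
  stepLabel o K y (stepLabel o K y a)
    ≡⟨ cong (stepLabel o K y) (label-injective os _ y (unfold e)) ⟩
  stepLabel o K y (stepLabel o K y b)
    ≡⟨ stepLabel-involutive o K y b ⟩
  b ∎
  where
  unfold : label (o ∷ os) K y a ≡ label (o ∷ os) K y b →
    label os (step o K) y (stepLabel o K y a) ≡ label os (step o K) y (stepLabel o K y b)
  unfold h = trans (sym (label-++ (o ∷ []) os K y a)) (trans h (label-++ (o ∷ []) os K y b))

record LinearInjection {n} (P : Column n → Column n) : Set where
  field
    pointwise : ∀ u v → (∀ i → u i ≡ v i) → ∀ i → P u i ≡ P v i
    additive  : ∀ u v i → P (λ j → u j xor v j) i ≡ P u i xor P v i
    injective : ∀ u → (∀ i → P u i ≡ false) → ∀ i → u i ≡ false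

module _ {n} {P : Column n → Column n} (L : LinearInjection P) where
  open LinearInjection L

  linear-zero : ∀ i → P (λ _ → false) i ≡ false
  linear-zero i = trans (additive (λ _ → false) (λ _ → false) i) (xor-same (P (λ _ → false) i))

  linear-scale : ∀ μ u j → P (λ i → μ ∧ u i) j ≡ μ ∧ P u j
  linear-scale false u j = linear-zero j
  linear-scale true u j = refl

  linear-combination : ∀ {m} (μ : Fin m → Bool) (v : Fin m → Column n) j →
    P (combination μ v) j ≡ combination μ (λ w → P (v w)) j
  linear-combination {zero} μ v j = linear-zero j
  linear-combination {suc m} μ v j =
    trans (additive (λ i → μ zero ∧ v zero i) (combination (μ ∘ suc) (v ∘ suc)) j)
          (cong₂ _xor_ (linear-scale (μ zero) (v zero) j) (linear-combination (μ ∘ suc) (v ∘ suc) j))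

linear-id : ∀ {n} → LinearInjection {n} id
linear-id = record { pointwise = λ u v h → h ; additive = λ u v i → refl ; injective = λ u h → h }

linear-∘ : ∀ {n} {P Q : Column n → Column n} →
  LinearInjection P → LinearInjection Q → LinearInjection (Q ∘ P)
linear-∘ {P = P} {Q} LP LQ = record
  { pointwise = λ u v h → LinearInjection.pointwise LQ (P u) (P v) (LinearInjection.pointwise LP u v h)
  ; additive = λ u v i → trans (LinearInjection.pointwise LQ _ _ (LinearInjection.additive LP u v) i)
                               (LinearInjection.additive LQ (P u) (P v) i)
  ; injective = λ u h → LinearInjection.injective LP u (LinearInjection.injective LQ (P u) h) }

-- Realized operation sequences: the induced isomorphism is the matroid
-- isomorphism given by an injective linear map P on columns.

record Realized {n} (K : Graph n) (os : List (Op n)) : Set where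
  field
    P         : Column n → Column n
    linear    : LinearInjection P
    transport : ∀ e i → col (apply os K) (induced os K e) i ≡ P (col K e) i
    symmetric : Symmetric (apply os K)

realized-[] : ∀ {n} {K : Graph n} → Symmetric K → Realized K []
realized-[] s = record { P = id ; linear = linear-id ; transport = λ e i → refl ; symmetric = s }

realized-++ : ∀ {n} {K : Graph n} {os₁ os₂} (R₁ : Realized K os₁) →
  Realized (apply os₁ K) os₂ → Realized K (os₁ ++ os₂)
realized-++ {K = K} {os₁} {os₂} R₁ R₂ = record
  { P = Realized.P R₂ ∘ Realized.P R₁
  ; linear = linear-∘ (Realized.linear R₁) (Realized.linear R₂)
  ; transport = λ e i → trans (split e i)
      (trans (Realized.transport R₂ (induced os₁ K e) i)
             (LinearInjection.pointwise (Realized.linear R₂) _ _ (Realized.transport R₁ e) i))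
  ; symmetric = λ x y → trans (cong (λ L → L x y) (apply-++ os₁ os₂ K))
      (trans (Realized.symmetric R₂ x y) (sym (cong (λ L → L y x) (apply-++ os₁ os₂ K)))) }
  where
  split : ∀ e i → col (apply (os₁ ++ os₂) K) (induced (os₁ ++ os₂) K e) i
                ≡ col (apply os₂ (apply os₁ K)) (induced os₂ (apply os₁ K) (induced os₁ K e)) i
  split e i = cong₂ (λ L e′ → col L e′ i) (apply-++ os₁ os₂ K) (induced-++ os₁ os₂ K e)

transport-vertex : ∀ {n} {K : Graph n} {os} (R : Realized K os) y a i →
  col (apply os K) (y , label os K y a) i ≡ Realized.P R (col K (y , a)) i
transport-vertex {K = K} {os} R y a i =
  trans (cong (λ e → col (apply os K) e i) (sym (induced-vertex os K y a))) (Realized.transport R (y , a) i)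

isNbr-self : ∀ {n} (K : Graph n) v → isNbr K v v ≡ false
isNbr-self K v = cong (λ b → not b ∧ K v v) (==-refl v)

isNbr-≢ : ∀ {n} (K : Graph n) {v x} → v ≢ x → isNbr K v x ≡ K v x
isNbr-≢ K {v} {x} v≢x = cong (λ b → not b ∧ K v x) (==-≢ v≢x)

non-φ-entry : ∀ {n} (K : Graph n) x a w → a ≢ φ → w ≢ x → col K (x , a) w ≡ K w x
non-φ-entry K x φ w a≢φ _ = contradiction refl a≢φ
non-φ-entry K x χ w _ _ = refl
non-φ-entry K x ψ w _ w≢x = trans (cong (K w x xor_) (==-≢ w≢x)) (xor-identityʳ (K w x))

-- The pivot G^v_ns is realized by the map adding coordinate v to every
-- coordinate that is a neighbour of v.

pivotMap : ∀ {n} → Graph n → Fin n → Column n → Column n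
pivotMap K v u i = u i xor (u v ∧ isNbr K v i)

pivotMap-linear : ∀ {n} (K : Graph n) v → LinearInjection (pivotMap K v)
pivotMap-linear K v = record
  { pointwise = λ u w h i → cong₂ (λ p q → p xor (q ∧ isNbr K v i)) (h i) (h v)
  ; additive = λ u w i → trans (cong ((u i xor w i) xor_) (∧-distribʳ-xor (isNbr K v i) (u v) (w v)))
                               (interchange (u i) (w i) _ _)
  ; injective = injective }
  where
  injective : ∀ u → (∀ i → pivotMap K v u i ≡ false) → ∀ i → u i ≡ false
  injective u h i = trans (sym (xor-identityʳ (u i)))
                          (trans (cong (λ t → u i xor (t ∧ isNbr K v i)) (sym uv≡false)) (h i))
    where
    uv≡false : u v ≡ false
    uv≡false = trans (sym (xor-identityʳ (u v)))
      (trans (cong (u v xor_) (trans (sym (∧-zeroʳ (u v))) (cong (u v ∧_) (sym (isNbr-self K v))))) (h v))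

pivotLabel : Bool → Label → Label
pivotLabel l a = if l then swap φ χ a else swap φ ψ a

entry : Label → Bool → Bool → Bool
entry φ e k = e
entry χ e k = k
entry ψ e k = k xor e

col-entry : ∀ {n} (K : Graph n) v a i → col K (v , a) i ≡ entry a (i == v) (K i v)
col-entry K v φ i = refl
col-entry K v χ i = refl
col-entry K v ψ i = refl

RowFrom : Bool → Bool → Bool → Bool → Set
RowFrom e nbr k l = (e ≡ true × nbr ≡ false × k ≡ l) ⊎ (e ≡ false × nbr ≡ k)

rowFrom : ∀ {n} (K : Graph n) → Symmetric K → ∀ v i → RowFrom (i == v) (isNbr K v i) (K i v) (K v v)
rowFrom K s v i with i ≟ v
... | yes refl = inj₁ (refl , isNbr-self K v , refl)
... | no i≢v = inj₂ (refl , trans (isNbr-≢ K (≢-sym i≢v)) (s v i))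

pivot-row : ∀ a l e nbr k → RowFrom e nbr k l →
  entry (pivotLabel l a) e ((nbr ∧ false) xor k) ≡ entry a e k xor (entry a true l ∧ nbr)
pivot-row φ true  _ _ _ (inj₁ (refl , refl , refl)) = refl
pivot-row φ false _ _ _ (inj₁ (refl , refl , refl)) = refl
pivot-row χ true  _ _ _ (inj₁ (refl , refl , refl)) = refl
pivot-row χ false _ _ _ (inj₁ (refl , refl , refl)) = refl
pivot-row ψ true  _ _ _ (inj₁ (refl , refl , refl)) = refl
pivot-row ψ false _ _ _ (inj₁ (refl , refl , refl)) = refl
pivot-row φ true  _ _ true  (inj₂ (refl , refl)) = refl
pivot-row φ true  _ _ false (inj₂ (refl , refl)) = refl
pivot-row φ false _ _ true  (inj₂ (refl , refl)) = refl
pivot-row φ false _ _ false (inj₂ (refl , refl)) = refl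
pivot-row χ true  _ _ true  (inj₂ (refl , refl)) = refl
pivot-row χ true  _ _ false (inj₂ (refl , refl)) = refl
pivot-row χ false _ _ true  (inj₂ (refl , refl)) = refl
pivot-row χ false _ _ false (inj₂ (refl , refl)) = refl
pivot-row ψ true  _ _ true  (inj₂ (refl , refl)) = refl
pivot-row ψ true  _ _ false (inj₂ (refl , refl)) = refl
pivot-row ψ false _ _ true  (inj₂ (refl , refl)) = refl
pivot-row ψ false _ _ false (inj₂ (refl , refl)) = refl

pivot-transport-centre : ∀ {n} (K : Graph n) → Symmetric K → ∀ v a i →
  col (step (opns v) K) (v , pivotLabel (K v v) a) i ≡ pivotMap K v (col K (v , a)) i
pivot-transport-centre K s v a i = begin
  col (step (opns v) K) (v , pivotLabel (K v v) a) i
    ≡⟨ col-entry (step (opns v) K) v (pivotLabel (K v v) a) i ⟩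
  entry (pivotLabel (K v v) a) (i == v) ((isNbr K v i ∧ isNbr K v v) xor K i v)
    ≡⟨ cong (λ t → entry (pivotLabel (K v v) a) (i == v) ((isNbr K v i ∧ t) xor K i v)) (isNbr-self K v) ⟩
  entry (pivotLabel (K v v) a) (i == v) ((isNbr K v i ∧ false) xor K i v)
    ≡⟨ pivot-row a (K v v) (i == v) (isNbr K v i) (K i v) (rowFrom K s v i) ⟩
  entry a (i == v) (K i v) xor (entry a true (K v v) ∧ isNbr K v i)
    ≡⟨ cong (λ t → entry a (i == v) (K i v) xor (entry a t (K v v) ∧ isNbr K v i)) (sym (==-refl v)) ⟩
  entry a (i == v) (K i v) xor (entry a (v == v) (K v v) ∧ isNbr K v i)
    ≡⟨ cong₂ (λ p q → p xor (q ∧ isNbr K v i)) (sym (col-entry K v a i)) (sym (col-entry K v a v)) ⟩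
  pivotMap K v (col K (v , a)) i ∎

pivot-transport : ∀ {n} (K : Graph n) → Symmetric K → ∀ v e i →
  col (step (opns v) K) (stepβ (opns v) K e) i ≡ pivotMap K v (col K e) i
pivot-transport K s v (x , a) i with x ≟ v
pivot-transport K s v (x , φ) i | no x≢v rewrite ==-≢ (≢-sym x≢v) = sym (xor-identityʳ (i == x))
pivot-transport K s v (x , χ) i | no x≢v rewrite isNbr-≢ K (≢-sym x≢v) =
  trans (xor-comm _ (K i x)) (cong (K i x xor_) (∧-comm (isNbr K v i) (K v x)))
pivot-transport K s v (x , ψ) i | no x≢v rewrite isNbr-≢ K (≢-sym x≢v) | ==-≢ (≢-sym x≢v)
  | xor-identityʳ (K v x) | ∧-comm (K v x) (isNbr K v i) = xy∙z≈yz∙x _ (K i x) (i == x)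
pivot-transport K s v (x , a) i | yes refl = pivot-transport-centre K s v a i

pivot-realized : ∀ {n} {K : Graph n} v → Symmetric K → Realized K (opns v ∷ [])
pivot-realized {K = K} v s = record
  { P = pivotMap K v ; linear = pivotMap-linear K v
  ; transport = pivot-transport K s v
  ; symmetric = λ x y → cong₂ _xor_ (∧-comm (isNbr K v x) (isNbr K v y)) (s x y) }

pivotLabel-φ : ∀ a l → a ≢ φ → entry a true l ≡ true → pivotLabel l a ≡ φ
pivotLabel-φ φ _ a≢φ _ = contradiction refl a≢φ
pivotLabel-φ χ true _ _ = refl
pivotLabel-φ χ false _ ()
pivotLabel-φ ψ true _ ()
pivotLabel-φ ψ false _ _ = refl

pivot-label-other : ∀ {n} (K : Graph n) v y a → y ≢ v → label (opns v ∷ []) K y a ≡ a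
pivot-label-other K v y a y≢v rewrite ==-≢ y≢v = refl

pivot-label-centre : ∀ {n} (K : Graph n) v a → a ≢ φ → col K (v , a) v ≡ true →
  label (opns v ∷ []) K v a ≡ φ
pivot-label-centre K v a a≢φ pivot rewrite ==-refl v =
  pivotLabel-φ a (K v v) a≢φ
    (trans (cong (λ t → entry a t (K v v)) (sym (==-refl v))) (trans (sym (col-entry K v a v)) pivot))

pivot-diagonal : ∀ {n} (K : Graph n) x w a → a ≢ φ → w ≢ x → col K (x , a) w ≡ true →
  col (step (opns w) K) (x , a) x ≡ not (col K (x , a) x)
pivot-diagonal K x w φ a≢φ _ _ = contradiction refl a≢φ
pivot-diagonal K x w χ _ w≢x entry-w rewrite isNbr-≢ K w≢x | entry-w = refl
pivot-diagonal K x w ψ a≢φ w≢x entry-w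
  rewrite isNbr-≢ K w≢x | trans (sym (non-φ-entry K x ψ w a≢φ w≢x)) entry-w =
  xor-assoc true (K x x) (x == x)

IndependentTransversal : ∀ {n} → Graph n → Transversal n → Set
IndependentTransversal {n} K D =
  ∀ (μ : Fin n → Bool) → (∀ i → combination μ (columns K D) i ≡ false) → ∀ w → μ w ≡ false

basis-independent : ∀ {n} (G : Graph n) (B : Transversal n) → Independent G (toSubset B) →
  IndependentTransversal G B
basis-independent G B indep μ vanish w with μ w in μw
... | false = refl
... | true = contradiction (select B μ , ⊆B , ((w , B w) , w∈) , vanishes) indep
  where
  ⊆B : select B μ ⊆ toSubset B
  ⊆B e h = ∧-conicalˡ _ _ h
  w∈ : select B μ (w , B w) ≡ true
  w∈ rewrite eqL-refl (B w) = μw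
  vanishes : ∀ i → sumCols G (select B μ) i ≡ false
  vanishes i = trans (sumCols-select G B μ i) (vanish i)

independent-transport : ∀ {n} {K : Graph n} {os} (R : Realized K os) (D : Transversal n) →
  IndependentTransversal K D → IndependentTransversal (apply os K) (λ y → label os K y (D y))
independent-transport {n} {K} {os} R D ind μ vanish = ind μ (injective _ pulledBack)
  where
  open Realized R
  open LinearInjection linear
  pulledBack : ∀ j → P (combination μ (columns K D)) j ≡ false
  pulledBack j = trans (linear-combination linear μ (columns K D) j)
    (trans (sum-cong-≗ (λ w → cong (μ w ∧_) (sym (transport-vertex R w (D w) j)))) (vanish j))

-- Step (1): pivoting a transversal onto Φ

-- after os, x is cleared: its label is φ, and the set of vertices with a
-- non-φ label has not grown
Cleared : ∀ {n} → Graph n → Transversal n → Fin n → Set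
Cleared {n} K D x = Σ (List (Op n)) λ os → Realized K os ×
  (∀ y → label os K y (D y) ≢ φ → y ≢ x × D y ≢ φ)

clear-pivot : ∀ {n} (K : Graph n) → Symmetric K → (D : Transversal n) → ∀ x →
  D x ≢ φ → col K (x , D x) x ≡ true → Cleared K D x
clear-pivot K s D x Dx≢φ pivot = opns x ∷ [] , pivot-realized x s , remaining
  where
  remaining : ∀ y → label (opns x ∷ []) K y (D y) ≢ φ → y ≢ x × D y ≢ φ
  remaining y ne = by-cases (y ≟ x)
    where
    by-cases : Dec (y ≡ x) → y ≢ x × D y ≢ φ
    by-cases (yes refl) = contradiction (pivot-label-centre K x (D x) Dx≢φ pivot) ne
    by-cases (no y≢x) = y≢x , λ Dy≡φ → ne (trans (pivot-label-other K x y (D y) y≢x) Dy≡φ)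

-- if x is not a pivot, its column has entry 1 at some w with D w ≠ φ;
-- otherwise it would be the sum of the columns φ(w) = D(w) over its support,
-- a dependency among the columns of D
partner : ∀ {n} (K : Graph n) (D : Transversal n) → IndependentTransversal K D → ∀ x →
  col K (x , D x) x ≡ false → ∃ λ w → col K (x , D x) w ≡ true × D w ≢ φ
partner {n} K D ind x not-pivot
  with any? (λ w → (col K (x , D x) w ≟B true) ×-dec ¬? (D w ≟L φ))
... | yes found = found
... | no none = contradiction (trans (sym μx≡true) (ind μ dependency x)) λ ()
  where
  μ : Fin n → Bool
  μ w = (x == w) ∨ col K (x , D x) w
  μx≡true : μ x ≡ true
  μx≡true = cong (_∨ col K (x , D x) x) (==-refl x)
  support-φ : ∀ w → col K (x , D x) w ≡ true → D w ≡ φ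
  support-φ w entry-w with D w ≟L φ
  ... | yes Dw≡φ = Dw≡φ
  ... | no Dw≢φ = contradiction (w , entry-w , Dw≢φ) none
  term : ∀ i w → μ w ∧ col K (w , D w) i
               ≡ (col K (x , D x) i ∧ (x == w)) xor (col K (x , D x) w ∧ (i == w))
  term i w with x ≟ w
  ... | yes refl rewrite not-pivot =
    sym (trans (xor-identityʳ _) (∧-identityʳ (col K (w , D w) i)))
  ... | no _ with col K (x , D x) w in entry-w
  ...   | false = sym (cong (_xor false) (∧-zeroʳ (col K (x , D x) i)))
  ...   | true rewrite support-φ w entry-w = cong (_xor (i == w)) (sym (∧-zeroʳ (col K (x , D x) i)))
  dependency : ∀ i → combination μ (columns K D) i ≡ false
  dependency i = begin
    combination μ (columns K D) i
      ≡⟨ sum-cong-≗ (term i) ⟩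
    sum (λ w → (col K (x , D x) i ∧ (x == w)) xor (col K (x , D x) w ∧ (i == w)))
      ≡⟨ ∑-distrib-+ (λ w → col K (x , D x) i ∧ (x == w)) (λ w → col K (x , D x) w ∧ (i == w)) ⟩
    sum (λ w → col K (x , D x) i ∧ (x == w)) xor sum (λ w → col K (x , D x) w ∧ (i == w))
      ≡⟨ cong₂ _xor_ (sum-sift x (λ _ → col K (x , D x) i)) (sum-sift i (col K (x , D x))) ⟩
    col K (x , D x) i xor col K (x , D x) i
      ≡⟨ xor-same (col K (x , D x) i) ⟩
    false ∎

-- otherwise pivot first on such a partner w, which makes x a pivot without
-- changing its label, and then on x
clear-via-partner : ∀ {n} (K : Graph n) → Symmetric K → (D : Transversal n) → ∀ x w →
  D x ≢ φ → col K (x , D x) x ≡ false → col K (x , D x) w ≡ true → D w ≢ φ → Cleared K D x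
clear-via-partner K s D x w Dx≢φ not-pivot entry-w Dw≢φ
  with clear-pivot K₁ (Realized.symmetric (pivot-realized w s)) D₁ x D₁x≢φ now-pivot
  where
  w≢x : w ≢ x
  w≢x refl = contradiction (trans (sym entry-w) not-pivot) λ ()
  K₁ : Graph _
  K₁ = step (opns w) K
  D₁ : Transversal _
  D₁ y = label (opns w ∷ []) K y (D y)
  D₁x≡Dx : D₁ x ≡ D x
  D₁x≡Dx = pivot-label-other K w x (D x) (≢-sym w≢x)
  D₁x≢φ : D₁ x ≢ φ
  D₁x≢φ D₁x≡φ = Dx≢φ (trans (sym D₁x≡Dx) D₁x≡φ)
  now-pivot : col K₁ (x , D₁ x) x ≡ true
  now-pivot = trans (cong (λ a → col K₁ (x , a) x) D₁x≡Dx)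
                    (trans (pivot-diagonal K x w (D x) Dx≢φ w≢x entry-w) (cong not not-pivot))
... | os , R , shrink = opns w ∷ os , realized-++ (pivot-realized w s) R , remaining
  where
  remaining : ∀ y → label (opns w ∷ os) K y (D y) ≢ φ → y ≢ x × D y ≢ φ
  remaining y ne with shrink y ne | y ≟ w
  ... | y≢x , _ | yes refl = y≢x , Dw≢φ
  ... | y≢x , D₁y≢φ | no y≢w =
    y≢x , λ Dy≡φ → D₁y≢φ (trans (pivot-label-other K w y (D y) y≢w) Dy≡φ)

clear-vertex : ∀ {n} (K : Graph n) → Symmetric K → (D : Transversal n) → IndependentTransversal K D →
  ∀ x → D x ≢ φ → Cleared K D x
clear-vertex K s D ind x Dx≢φ with col K (x , D x) x in pivot
... | true = clear-pivot K s D x Dx≢φ pivot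
... | false with partner K D ind x pivot
...   | w , entry-w , Dw≢φ = clear-via-partner K s D x w Dx≢φ pivot entry-w Dw≢φ

ToΦ : ∀ {n} → Graph n → Transversal n → Set
ToΦ {n} K D = Σ (List (Op n)) λ os → Realized K os × (∀ y → label os K y (D y) ≡ φ)

toΦ : ∀ {n} (L : List (Fin n)) (K : Graph n) → Symmetric K → (D : Transversal n) →
  IndependentTransversal K D → (∀ y → D y ≢ φ → y ∈ₗ L) → ToΦ K D
toΦ [] K s D ind covered = [] , realized-[] s , allφ
  where
  allφ : ∀ y → D y ≡ φ
  allφ y with D y ≟L φ
  ... | yes Dy≡φ = Dy≡φ
  ... | no Dy≢φ with covered y Dy≢φ
  ...   | ()
toΦ (x ∷ L) K s D ind covered with D x ≟L φ
... | yes Dx≡φ = toΦ L K s D ind (λ y Dy≢φ → tail (λ { refl → Dy≢φ Dx≡φ }) (covered y Dy≢φ))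
... | no Dx≢φ with clear-vertex K s D ind x Dx≢φ
...   | os₁ , R₁ , shrink
  with toΦ L (apply os₁ K) (Realized.symmetric R₁) (λ y → label os₁ K y (D y))
           (independent-transport R₁ D ind)
           (λ y ne → tail (proj₁ (shrink y ne)) (covered y (proj₂ (shrink y ne))))
...     | os₂ , R₂ , ontoΦ =
  os₁ ++ os₂ , realized-++ R₁ R₂ , λ y → trans (label-++ os₁ os₂ K y (D y)) (ontoΦ y)

-- Step (2): fundamental circuits with respect to an independent transversal

module FundamentalCircuit {n} (G : Graph n) (B : Transversal n) (indB : IndependentTransversal G B)
  (x : Fin n) (c : Label) (Bx≢c : B x ≢ c) (μ : Fin n → Bool)
  (represents : ∀ i → col G (x , c) i xor combination μ (columns G B) i ≡ false) where

  e : W n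
  e = (x , c)

  Inside : Subset n → Set
  Inside T = T ⊆ insert e (toSubset B)

  ZeroSum : Subset n → Set
  ZeroSum T = ∀ i → sumCols G T i ≡ false

  inserted-point : ∀ {w a} → (x == w) ∧ eqL c a ≡ true → x ≡ w × c ≡ a
  inserted-point {w} {a} h = ==-≡ (∧-conicalˡ (x == w) _ h) , eqL-≡ (∧-conicalʳ (x == w) _ h)

  coefficients-unique : ∀ T → Inside T → T e ≡ true → ZeroSum T → ∀ w → T (w , B w) ≡ μ w
  coefficients-unique T inside Te vanishes w =
    xor≡false⇒≡ (τ w) (μ w) (indB (λ v → τ v xor μ v) difference w)
    where
    τ : Fin n → Bool
    τ v = T (v , B v)
    byT : ∀ i → col G e i ≡ combination τ (columns G B) i
    byT i = xor≡false⇒≡ _ _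
      (trans (cong (λ t → (t ∧ col G e i) xor combination τ (columns G B) i) (sym Te))
             (trans (sym (sumCols-split G B x c Bx≢c T inside i)) (vanishes i)))
    difference : ∀ i → combination (λ v → τ v xor μ v) (columns G B) i ≡ false
    difference i = begin
      combination (λ v → τ v xor μ v) (columns G B) i
        ≡⟨ combination-xor τ μ (columns G B) i ⟩
      combination τ (columns G B) i xor combination μ (columns G B) i
        ≡⟨ cong₂ _xor_ (sym (byT i)) (sym (xor≡false⇒≡ _ _ (represents i))) ⟩
      col G e i xor col G e i
        ≡⟨ xor-same (col G e i) ⟩
      false ∎

  contains-e : ∀ T → Inside T → (∃ λ f → f ∈ T) → ZeroSum T → T e ≡ true
  contains-e T inside ((w , a) , wa∈T) vanishes with T e in Te
  ... | true = refl
  ... | false = excluded (∨-true (inside (w , a) wa∈T))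
    where
    B-part-empty : ∀ v → T (v , B v) ≡ false
    B-part-empty = indB (λ v → T (v , B v)) λ i →
      trans (cong (λ t → (t ∧ col G e i) xor combination (λ v → T (v , B v)) (columns G B) i) (sym Te))
            (trans (sym (sumCols-split G B x c Bx≢c T inside i)) (vanishes i))
    excluded : (x == w) ∧ eqL c a ≡ true ⊎ eqL (B w) a ≡ true → false ≡ true
    excluded (inj₁ at-e) with inserted-point at-e
    ... | refl , refl = trans (sym Te) wa∈T
    excluded (inj₂ at-B) with eqL-≡ {B w} {a} at-B
    ... | refl = trans (sym (B-part-empty w)) wa∈T

  Circ : Subset n
  Circ = insert e (select B μ)

  Circ-inside : Inside Circ
  Circ-inside (w , a) = ∨-∧-weaken ((x == w) ∧ eqL c a) (eqL (B w) a) (μ w)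

  Circ-e : Circ e ≡ true
  Circ-e rewrite ==-refl x | eqL-refl c = refl

  Circ-B : ∀ w → Circ (w , B w) ≡ μ w
  Circ-B w with x ≟ w
  ... | yes refl rewrite eqL-≢ (≢-sym Bx≢c) | eqL-refl (B w) = refl
  ... | no _ rewrite eqL-refl (B w) = refl

  Circ-zero : ZeroSum Circ
  Circ-zero i = begin
    sumCols G Circ i
      ≡⟨ sumCols-split G B x c Bx≢c Circ Circ-inside i ⟩
    (Circ e ∧ col G e i) xor combination (λ w → Circ (w , B w)) (columns G B) i
      ≡⟨ cong₂ (λ s t → (s ∧ col G e i) xor t)
               Circ-e (sum-cong-≗ (λ w → cong (_∧ col G (w , B w) i) (Circ-B w))) ⟩
    col G e i xor combination μ (columns G B) i
      ≡⟨ represents i ⟩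
    false ∎

  Circ-least : ∀ T → Inside T → (∃ λ f → f ∈ T) → ZeroSum T → Circ ⊆ T
  Circ-least T inside nonempty vanishes (w , a) wa∈Circ with ∨-true {(x == w) ∧ eqL c a} wa∈Circ
  ... | inj₁ at-e with inserted-point at-e
  ...   | refl , refl = contains-e T inside nonempty vanishes
  Circ-least T inside nonempty vanishes (w , a) wa∈Circ | inj₂ at-B
    with eqL-≡ {B w} {a} (∧-conicalˡ _ _ at-B)
  ...   | refl = trans (coefficients-unique T inside (contains-e T inside nonempty vanishes) vanishes w)
                       (∧-conicalʳ (eqL (B w) (B w)) _ at-B)

  circuit : IsCircuit G Circ
  circuit = (Circ , (λ _ h → h) , (e , Circ-e) , Circ-zero) , minimal
    where
    minimal : ∀ T → T ⊆ Circ → Dependent G T → Circ ⊆ T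
    minimal T T⊆Circ (T′ , T′⊆T , nonempty , vanishes) f f∈Circ =
      T′⊆T f (Circ-least T′ inside nonempty vanishes f f∈Circ)
      where
      inside : Inside T′
      inside g g∈T′ = Circ-inside g (T⊆Circ g (T′⊆T g g∈T′))

  fundamental-circuit : ∀ y → InFundCircuit G (toSubset B) e (y , B y) ⇔ μ y ≡ true
  fundamental-circuit y = mk⇔ to from
    where
    to : InFundCircuit G (toSubset B) e (y , B y) → μ y ≡ true
    to (D , ((T , T⊆D , nonempty , vanishes) , minD) , D-inside , y∈D) =
      trans (sym (coefficients-unique T inside (contains-e T inside nonempty vanishes) vanishes y))
            (minD T T⊆D (T , (λ _ h → h) , nonempty , vanishes) (y , B y) y∈D)
      where
      inside : Inside T
      inside f f∈T = D-inside f (T⊆D f f∈T)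
    from : μ y ≡ true → InFundCircuit G (toSubset B) e (y , B y)
    from μy = Circ , circuit , Circ-inside , trans (Circ-B y) μy

-- After a realized sequence taking B to Φ, the coefficient vector of any
-- column with respect to B is its image under P, and for e = (x , c) with
-- c ≠ B(x) its entries are read off from column x of the new adjacency matrix.
module Pivoted {n} (G : Graph n) (B : Transversal n) (os : List (Op n)) (R : Realized G os)
  (ontoΦ : ∀ y → label os G y (B y) ≡ φ) where
  open Realized R
  open LinearInjection linear

  G₁ : Graph n
  G₁ = apply os G

  B-unit : ∀ w j → P (columns G B w) j ≡ (j == w)
  B-unit w j = trans (sym (transport-vertex R w (B w) j)) (cong (λ a → col G₁ (w , a) j) (ontoΦ w))

  represents : ∀ f i → col G f i xor combination (P (col G f)) (columns G B) i ≡ false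
  represents f = injective (λ i → col G f i xor combination μ (columns G B) i) λ j → begin
    P (λ i → col G f i xor combination μ (columns G B) i) j
      ≡⟨ additive (col G f) (combination μ (columns G B)) j ⟩
    μ j xor P (combination μ (columns G B)) j
      ≡⟨ cong (μ j xor_) (linear-combination linear μ (columns G B) j) ⟩
    μ j xor combination μ (λ w → P (columns G B w)) j
      ≡⟨ cong (μ j xor_) (sum-cong-≗ (λ w → cong (μ w ∧_) (B-unit w j))) ⟩
    μ j xor sum (λ w → μ w ∧ (j == w))
      ≡⟨ cong (μ j xor_) (sum-sift j μ) ⟩
    μ j xor μ j
      ≡⟨ xor-same (μ j) ⟩
    false ∎
    where
    μ : Fin n → Bool
    μ = P (col G f)

  -- the image of (x , c) is χ(x) or ψ(x), whose off-diagonal entries are A(G₁)(y , x)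
  coefficient-entry : ∀ x c → c ≢ B x → ∀ y → y ≢ x → P (col G (x , c)) y ≡ G₁ y x
  coefficient-entry x c c≢Bx y y≢x =
    trans (sym (transport-vertex R x c y)) (non-φ-entry G₁ x (label os G x c) y not-φ y≢x)
    where
    not-φ : label os G x c ≢ φ
    not-φ h = c≢Bx (label-injective os G x (trans h (sym (ontoΦ x))))

  fundamental-circuit-adjacency : IndependentTransversal G B → ∀ x c → B x ≢ c → ∀ y → y ≢ x →
    InFundCircuit G (toSubset B) (x , c) (y , B y) ⇔ G₁ x y ≡ true
  fundamental-circuit-adjacency indB x c Bx≢c y y≢x =
    ⇔-trans (FundamentalCircuit.fundamental-circuit G B indB x c Bx≢c
               (P (col G (x , c))) (represents (x , c)) y)
            (mk⇔ (trans (sym coefficient≡entry)) (trans coefficient≡entry))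
    where
    coefficient≡entry : P (col G (x , c)) y ≡ G₁ x y
    coefficient≡entry = trans (coefficient-entry x c (≢-sym Bx≢c) y y≢x) (symmetric y x)

-- Step (3): toggling loops

loop-off-diagonal : ∀ {n} (K : Graph n) v x y → x ≢ y → step (opℓ v) K x y ≡ K x y
loop-off-diagonal K v x y x≢y with x ≟ v | y ≟ v
... | yes refl | yes refl = contradiction refl x≢y
... | yes _ | no _ = refl
... | no _ | _ = refl

loop-diagonal-centre : ∀ {n} (K : Graph n) v → step (opℓ v) K v v ≡ not (K v v)
loop-diagonal-centre K v rewrite ==-refl v = refl

loop-diagonal-other : ∀ {n} (K : Graph n) v y → y ≢ v → step (opℓ v) K y y ≡ K y y
loop-diagonal-other K v y y≢v rewrite ==-≢ y≢v = refl

LoopsMatched : ∀ {n} (H K : Graph n) → List (Fin n) → Set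
LoopsMatched {n} H K L = Σ (List (Op n)) λ os →
  (∀ x y → x ≢ y → apply os K x y ≡ K x y) ×
  (∀ y → y ∈ₗ L ⊎ K y y ≡ H y y → apply os K y y ≡ H y y) ×
  (∀ y → label os K y φ ≡ φ)

matchLoops : ∀ {n} (H : Graph n) (L : List (Fin n)) (K : Graph n) → LoopsMatched H K L
matchLoops H [] K = [] , (λ _ _ _ → refl) , diagonal , (λ _ → refl)
  where
  diagonal : ∀ y → y ∈ₗ [] ⊎ K y y ≡ H y y → K y y ≡ H y y
  diagonal y (inj₂ agree) = agree
matchLoops H (x ∷ L) K with K x x ≟B H x x
... | yes agree-x with matchLoops H L K
...   | os , off , diagonal , keepsφ = os , off , diagonal′ , keepsφ
  where
  diagonal′ : ∀ y → y ∈ₗ x ∷ L ⊎ K y y ≡ H y y → apply os K y y ≡ H y y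
  diagonal′ y (inj₁ (here refl)) = diagonal y (inj₂ agree-x)
  diagonal′ y (inj₁ (there y∈L)) = diagonal y (inj₁ y∈L)
  diagonal′ y (inj₂ agree) = diagonal y (inj₂ agree)
matchLoops H (x ∷ L) K | no differ-x with matchLoops H L (step (opℓ x) K)
...   | os , off , diagonal , keepsφ = opℓ x ∷ os , off′ , diagonal′ , keepsφ′
  where
  off′ : ∀ a b → a ≢ b → apply os (step (opℓ x) K) a b ≡ K a b
  off′ a b a≢b = trans (off a b a≢b) (loop-off-diagonal K x a b a≢b)
  diagonal′ : ∀ y → y ∈ₗ x ∷ L ⊎ K y y ≡ H y y → apply os (step (opℓ x) K) y y ≡ H y y
  diagonal′ y h with y ≟ x
  ... | yes refl = diagonal y (inj₂ (trans (loop-diagonal-centre K y) (sym (¬-not (≢-sym differ-x)))))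
  ... | no y≢x = diagonal y (untoggled h)
    where
    untoggled : y ∈ₗ x ∷ L ⊎ K y y ≡ H y y → y ∈ₗ L ⊎ step (opℓ x) K y y ≡ H y y
    untoggled (inj₁ y∈xL) = inj₁ (tail y≢x y∈xL)
    untoggled (inj₂ agree) = inj₂ (trans (loop-diagonal-other K x y y≢x) agree)
  keepsφ′ : ∀ y → label (opℓ x ∷ os) K y φ ≡ φ
  keepsφ′ y = trans (cong (label os (step (opℓ x) K) y) (if-eta (y == x))) (keepsφ y)

corollary39 : (n : ℕ) (G : Graph n) → Symmetric G →
    (B : Transversal n) → IsBasis G (toSubset B) →
    (C : Transversal n) → (∀ v → B v ≢ C v) →
    (H : Graph n) → Symmetric H →
    (∀ v w → v ≢ w → (H v w ≡ true ⇔ InFundCircuit G (toSubset B) (v , C v) (w , B w))) →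
    ∃ λ (os : List (Op n)) → apply os G ≈G H ×
      (∀ v → ∃ λ w → induced os G (v , B v) ≡ (w , φ)) ×
      (∀ w → ∃ λ v → induced os G (v , B v) ≡ (w , φ))
corollary39 n G sG B basis C B≢C H _ fundamental
  with toΦ (allFin n) G sG B (basis-independent G B (proj₁ basis)) (λ y _ → ∈-allFin y)
... | os₁ , R₁ , ontoΦ with matchLoops H (allFin n) (apply os₁ G)
...   | os₂ , off , diagonal , keepsφ = os₁ ++ os₂ , agrees , (λ v → v , B↦φ v) , (λ w → w , B↦φ w)
  where
  open Pivoted G B os₁ R₁ ontoΦ using (G₁; fundamental-circuit-adjacency)
  adjacency : ∀ v w → v ≢ w → G₁ v w ≡ H v w
  adjacency v w v≢w = sym (⇔-true⇒≡ (⇔-trans (fundamental v w v≢w)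
    (fundamental-circuit-adjacency (basis-independent G B (proj₁ basis)) v (C v) (B≢C v) w (≢-sym v≢w))))
  agrees : apply (os₁ ++ os₂) G ≈G H
  agrees v w rewrite apply-++ os₁ os₂ G with v ≟ w
  ... | yes refl = diagonal v (inj₁ (∈-allFin v))
  ... | no v≢w = trans (off v w v≢w) (adjacency v w v≢w)
  B↦φ : ∀ v → induced (os₁ ++ os₂) G (v , B v) ≡ (v , φ)
  B↦φ v = trans (induced-vertex (os₁ ++ os₂) G v (B v))
    (cong (v ,_) (trans (label-++ os₁ os₂ G v (B v)) (trans (cong (label os₂ G₁ v) (ontoΦ v)) (keepsφ v))))
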